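{- Let $R \cong F_1 \times F_2 \times \cdots \times F_n$ with $n \ge 3$, where each $F_i$ is a finite field. Then for any two distinct vertices $I, J$ of $\mathrm{PIS}(R)$ we have $N(I) \neq N(J)$.
   Context: For a commutative ring $R$ with unity, the prime ideal sum graph $\mathrm{PIS}(R)$ is the simple undirected graph whose vertex set is the set of all nonzero proper ideals of $R$, with two distinct vertices $I$ and $J$ adjacent if and only if $I+J$ is a prime ideal of $R$. $N(x)$ denotes the set of neighbors of a vertex $x$. -}

module Defs where

open import Level using (Level; _⊔_; suc)
open import Algebra.Bundles using (CommutativeRing)
open import Data.Fin using (Fin)
open import Data.Nat using (ℕ)
open import Data.Product using (Σ; ∃; _×_; _,_)
open import Data.Sum using (_⊎_)
open import Relation.Nullary using (¬_)
open import Relation.Unary using (Pred)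

module IdealTheory {c ℓ} (R : CommutativeRing c ℓ) where
  open CommutativeRing R

  Subset : Set (suc (c ⊔ ℓ))
  Subset = Pred Carrier (c ⊔ ℓ)

  record IsIdeal (I : Subset) : Set (c ⊔ ℓ) where
    field
      resp  : ∀ {x y} → x ≈ y → I x → I y
      zero∈ : I 0#
      +-closed : ∀ {x y} → I x → I y → I (x + y)
      neg-closed : ∀ {x} → I x → I (- x)
      *-closed : ∀ r {x} → I x → I (r * x)

  record Ideal : Set (suc (c ⊔ ℓ)) where
    field
      set     : Subset
      isIdeal : IsIdeal set
  open Ideal public

  _≐_ : Ideal → Ideal → Set (c ⊔ ℓ)
  I ≐ J = (∀ x → set I x → set J x) × (∀ x → set J x → set I x)

  _⊕_ : Ideal → Ideal → Subset
  (I ⊕ J) x = Σ Carrier λ a → Σ Carrier λ b → set I a × set J b × (x ≈ a + b)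

  record IsPrime (P : Subset) : Set (c ⊔ ℓ) where
    field
      isIdeal : IsIdeal P
      proper  : ¬ P 1#
      prime   : ∀ a b → P (a * b) → P a ⊎ P b

  IsVertex : Ideal → Set (c ⊔ ℓ)
  IsVertex I = (Σ Carrier λ x → set I x × ¬ (x ≈ 0#)) × ¬ set I 1#

  _∈N[_] : Ideal → Ideal → Set (c ⊔ ℓ)
  K ∈N[ I ] = IsVertex K × ¬ (K ≐ I) × IsPrime (I ⊕ K)

  SameNeighbourhood : Ideal → Ideal → Set (suc (c ⊔ ℓ))
  SameNeighbourhood I J = ∀ K → (K ∈N[ I ] → K ∈N[ J ]) × (K ∈N[ J ] → K ∈N[ I ])

module _ {c ℓ} (F : CommutativeRing c ℓ) where
  open CommutativeRing F

  IsField : Set (c ⊔ ℓ)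
  IsField = ¬ (1# ≈ 0#) × (∀ x → ¬ (x ≈ 0#) → Σ Carrier λ y → x * y ≈ 1#)

  IsFinite : Set (c ⊔ ℓ)
  IsFinite = Σ ℕ λ m → Σ (Fin m → Carrier) λ e → ∀ x → Σ (Fin m) λ k → e k ≈ x

module _ {c ℓ c' ℓ'} (R : CommutativeRing c ℓ) {n : ℕ}
         (F : Fin n → CommutativeRing c' ℓ') where
  private
    module R = CommutativeRing R
    module F (i : Fin n) = CommutativeRing (F i)

  Prod : Set c'
  Prod = (i : Fin n) → F.Carrier i

  _≈ₚ_ : Prod → Prod → Set ℓ'
  u ≈ₚ v = ∀ i → F._≈_ i (u i) (v i)

  record IsRingIsoToProduct (φ : R.Carrier → Prod) : Set (c ⊔ ℓ ⊔ c' ⊔ ℓ') where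
    field
      cong      : ∀ {x y} → x R.≈ y → φ x ≈ₚ φ y
      +-homo    : ∀ x y → φ (x R.+ y) ≈ₚ (λ i → F._+_ i (φ x i) (φ y i))
      *-homo    : ∀ x y → φ (x R.* y) ≈ₚ (λ i → F._*_ i (φ x i) (φ y i))
      1-homo    : φ R.1# ≈ₚ (λ i → F.1# i)
      injective : ∀ {x y} → φ x ≈ₚ φ y → x R.≈ y
      surjective : ∀ v → Σ R.Carrier λ x → φ x ≈ₚ v

  _≅Π_ : Set (c ⊔ ℓ ⊔ c' ⊔ ℓ')
  _≅Π_ = Σ (R.Carrier → Prod) IsRingIsoToProduct

-- Write e i for the unit vectors of R ≅ F₀ × ⋯ × Fₙ₋₁. Since x = ∑ᵢ e i * x, an ideal contains x
-- iff it contains e i for every coordinate i with xᵢ ≠ 0; so an ideal is determined by its support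
-- { i | e i ∈ I }, supports add under I + K, and an ideal whose support misses exactly one
-- coordinate is prime, while one with full support is not proper.
-- Suppose e i ∈ I, e i ∉ J and N(I) = N(J). Testing against the maximal ideals 𝔪 m (support all
-- but m) forces J to have support all but i, and then I to miss at most one coordinate m ≠ i.
-- If it missed m, the ideal ⟨ e i ⟩ would be a neighbour of I (a third coordinate, n ≥ 3,
-- separates it from I) but not of J, as J + ⟨ e i ⟩ = R. Hence I = R, a contradiction.
-- All case distinctions (on supports, and on zero in the finite fields) are only available
-- doubly negated, which suffices for the negative goal.

module Submission where

open import Defs
open import Algebra.Bundles using (CommutativeRing; CommutativeMonoid)
open import Data.Fin using (Fin; zero; suc)
open import Data.Fin.Properties using (_≟_; punchInᵢ≢i; sequence)
open import Data.Nat using (ℕ; zero; suc; _≥_; z≤n; s≤s)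
open import Data.Product using (Σ; ∃; _×_; _,_; proj₁; proj₂; swap)
open import Data.Sum using (_⊎_; inj₁; inj₂; [_,_]′)
open import Data.Empty using (⊥; ⊥-elim)
open import Data.Vec.Functional using (Vector; removeAt)
open import Effect.Monad using (RawMonad)
open import Relation.Nullary using (¬_; Dec; yes; no)
open import Relation.Nullary.Decidable using (map′; ¬¬-excluded-middle; decidable-stable)
open import Relation.Nullary.Negation using (¬¬-Monad)
open import Relation.Binary.Definitions using (_Respects_)
open import Relation.Binary.PropositionalEquality as PropEq using (_≡_; _≢_; refl; ≢-sym)
open import Relation.Unary using (Pred)
import Algebra.Properties.CommutativeMonoid.Sum as CommutativeMonoidSum
import Algebra.Properties.Ring as RingProperties
import Algebra.Properties.CommutativeSemigroup as CommutativeSemigroupProperties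
import Relation.Binary.Reasoning.Setoid as SetoidReasoning

¬¬-sequence : ∀ {a n} {P : Fin n → Set a} → (∀ i → ¬ ¬ P i) → ¬ ¬ (∀ i → P i)
¬¬-sequence = sequence (RawMonad.rawApplicative ¬¬-Monad)

all-but-one : ∀ {a n} {P : Fin n → Set a} i → P i → (∀ j → j ≢ i → P j) → ∀ j → P j
all-but-one i pᵢ p j with j ≟ i
... | yes refl = pᵢ
... | no j≢i = p j j≢i

avoid-two : ∀ {n} (i m : Fin (suc (suc (suc n)))) → ∃ λ k → k ≢ i × k ≢ m
avoid-two zero          zero          = suc zero , (λ ()) , (λ ())
avoid-two zero          (suc zero)    = suc (suc zero) , (λ ()) , (λ ())
avoid-two zero          (suc (suc _)) = suc zero , (λ ()) , (λ ())
avoid-two (suc zero)    zero          = suc (suc zero) , (λ ()) , (λ ())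
avoid-two (suc zero)    (suc _)       = zero , (λ ()) , (λ ())
avoid-two (suc (suc _)) zero          = suc zero , (λ ()) , (λ ())
avoid-two (suc (suc _)) (suc _)       = zero , (λ ()) , (λ ())

finite⇒¬¬-decidable : ∀ {c ℓ p} (F : CommutativeRing c ℓ) → IsFinite F →
  let open CommutativeRing F in
  {P : Pred Carrier p} → P Respects _≈_ → ¬ ¬ (∀ x → Dec (P x))
finite⇒¬¬-decidable F (m , enum , onto) {P} resp ¬dec =
  ¬¬-sequence (λ k → ¬¬-excluded-middle {A = P (enum k)}) λ dec →
  ¬dec λ x → let (k , enum-k≈x) = onto x in
    map′ (resp enum-k≈x) (resp (sym enum-k≈x)) (dec k)
  where open CommutativeRing F

module _ {c ℓ} (M : CommutativeMonoid c ℓ) where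
  open CommutativeMonoid M renaming (_∙_ to _+_; ε to 0#)
  open CommutativeMonoidSum M

  sum-concentrated : ∀ {n} (t : Vector Carrier n) j → (∀ i → i ≢ j → t i ≈ 0#) → sum t ≈ t j
  sum-concentrated {suc n} t j t≈0 = begin
    sum t                       ≈⟨ sum-remove t ⟩
    t j + sum (removeAt t j)    ≈⟨ ∙-congˡ (trans (sum-cong-≋ λ k → t≈0 _ (punchInᵢ≢i j k)) (sum-replicate-zero n)) ⟩
    t j + 0#                    ≈⟨ identityʳ (t j) ⟩
    t j                         ∎
    where open SetoidReasoning setoid

module FieldProperties {c ℓ} (F : CommutativeRing c ℓ) (isField : IsField F) where
  open CommutativeRing F

  1≉0 : ¬ 1# ≈ 0#
  1≉0 = proj₁ isField

  _⁻¹[_] : ∀ x → ¬ x ≈ 0# → Carrier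
  x ⁻¹[ x≉0 ] = proj₁ (proj₂ isField x x≉0)

  inverseˡ : ∀ x (x≉0 : ¬ x ≈ 0#) → x ⁻¹[ x≉0 ] * x ≈ 1#
  inverseˡ x x≉0 = trans (*-comm _ x) (proj₂ (proj₂ isField x x≉0))

  *-≉0 : ∀ {x y} → ¬ x ≈ 0# → ¬ y ≈ 0# → ¬ x * y ≈ 0#
  *-≉0 {x} {y} x≉0 y≉0 xy≈0 = y≉0 (begin
    y                          ≈⟨ *-identityˡ y ⟨
    1# * y                     ≈⟨ *-congʳ (inverseˡ x x≉0) ⟨
    x ⁻¹[ x≉0 ] * x * y        ≈⟨ *-assoc _ x y ⟩
    x ⁻¹[ x≉0 ] * (x * y)      ≈⟨ *-congˡ xy≈0 ⟩
    x ⁻¹[ x≉0 ] * 0#           ≈⟨ zeroʳ _ ⟩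
    0#                         ∎)
    where open SetoidReasoning setoid

module IdealProperties {c ℓ} (R : CommutativeRing c ℓ) where
  open CommutativeRing R hiding (zero)
  open IdealTheory R
  open RingProperties ring using (-‿distribˡ-*; -‿+-comm)
  open CommutativeSemigroupProperties +-commutativeSemigroup using (interchange)
  open CommutativeMonoidSum +-commutativeMonoid using (sum)

  module _ {P : Subset} (isIdeal : IsIdeal P) where
    open IsIdeal isIdeal

    ∉⇒1∉ : ∀ {x} → ¬ P x → ¬ P 1#
    ∉⇒1∉ {x} x∉P 1∈P = x∉P (resp (*-identityʳ x) (*-closed x 1∈P))

    sum-closed : ∀ {n} (t : Vector Carrier n) → (∀ i → P (t i)) → P (sum t)
    sum-closed {zero}  t t∈P = zero∈
    sum-closed {suc n} t t∈P = +-closed (t∈P zero) (sum-closed (λ i → t (suc i)) (λ i → t∈P (suc i)))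

  ⊕-isIdeal : (I K : Ideal) → IsIdeal (I ⊕ K)
  ⊕-isIdeal I K = record
    { resp       = λ { x≈y (a , b , a∈I , b∈K , x≈a+b) → a , b , a∈I , b∈K , trans (sym x≈y) x≈a+b }
    ; zero∈      = 0# , 0# , I.zero∈ , K.zero∈ , sym (+-identityʳ 0#)
    ; +-closed   = λ { (a , b , a∈I , b∈K , x≈a+b) (a′ , b′ , a′∈I , b′∈K , y≈a′+b′) →
                     a + a′ , b + b′ , I.+-closed a∈I a′∈I , K.+-closed b∈K b′∈K ,
                     trans (+-cong x≈a+b y≈a′+b′) (interchange a b a′ b′) }
    ; neg-closed = λ { (a , b , a∈I , b∈K , x≈a+b) →
                     - a , - b , I.neg-closed a∈I , K.neg-closed b∈K ,
                     trans (-‿cong x≈a+b) (sym (-‿+-comm a b)) }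
    ; *-closed   = λ { r (a , b , a∈I , b∈K , x≈a+b) →
                     r * a , r * b , I.*-closed r a∈I , K.*-closed r b∈K ,
                     trans (*-congˡ x≈a+b) (distribˡ r a b) }
    }
    where
      module I = IsIdeal (isIdeal I)
      module K = IsIdeal (isIdeal K)

  ⊕-inˡ : ∀ (I K : Ideal) {x} → set I x → (I ⊕ K) x
  ⊕-inˡ I K {x} x∈I = x , 0# , x∈I , IsIdeal.zero∈ (isIdeal K) , sym (+-identityʳ x)

  ⊕-inʳ : ∀ (I K : Ideal) {x} → set K x → (I ⊕ K) x
  ⊕-inʳ I K {x} x∈K = 0# , x , IsIdeal.zero∈ (isIdeal I) , x∈K , sym (+-identityˡ x)

  ⟨_⟩ : Carrier → Ideal
  ⟨ s ⟩ = record
    { set     = λ x → Σ Carrier λ r → x ≈ r * s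
    ; isIdeal = record
      { resp       = λ { x≈y (r , x≈rs) → r , trans (sym x≈y) x≈rs }
      ; zero∈      = 0# , sym (zeroˡ s)
      ; +-closed   = λ { (r , x≈rs) (r′ , y≈r′s) → r + r′ , trans (+-cong x≈rs y≈r′s) (sym (distribʳ s r r′)) }
      ; neg-closed = λ { (r , x≈rs) → - r , trans (-‿cong x≈rs) (-‿distribˡ-* r s) }
      ; *-closed   = λ { t (r , x≈rs) → t * r , trans (*-congˡ x≈rs) (sym (*-assoc t r s)) }
      }
    }


module ProductOfFields {c ℓ c' ℓ'} (R : CommutativeRing c ℓ) {n : ℕ}
  (F : Fin n → CommutativeRing c' ℓ') (isField : ∀ i → IsField (F i))
  (φ : CommutativeRing.Carrier R → Prod R F) (isIso : IsRingIsoToProduct R F φ)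
  (≈0? : ∀ i x → Dec (CommutativeRing._≈_ (F i) x (CommutativeRing.0# (F i))))
  where
  module R = CommutativeRing R
  module Fᵢ (i : Fin n) = CommutativeRing (F i)
  module FieldPropertiesᵢ (i : Fin n) = FieldProperties (F i) (isField i)
  module Sumᵢ (i : Fin n) = CommutativeMonoidSum (Fᵢ.+-commutativeMonoid i)
  open IsRingIsoToProduct isIso renaming (cong to φ-cong)
  open IdealTheory R
  open IdealProperties R
  open CommutativeMonoidSum R.+-commutativeMonoid using (sum)

  ψ : Prod R F → R.Carrier
  ψ v = proj₁ (surjective v)

  φ-ψ : ∀ v j → Fᵢ._≈_ j (φ (ψ v) j) (v j)
  φ-ψ v = proj₂ (surjective v)

  φ-ψ* : ∀ v x j → Fᵢ._≈_ j (φ (ψ v R.* x) j) (Fᵢ._*_ j (v j) (φ x j))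
  φ-ψ* v x j = Fᵢ.trans j (*-homo (ψ v) x j) (Fᵢ.*-congʳ j (φ-ψ v j))

  0ₚ 1ₚ : Prod R F
  0ₚ j = Fᵢ.0# j
  1ₚ j = Fᵢ.1# j

  φ-0# : ∀ j → Fᵢ._≈_ j (φ R.0# j) (Fᵢ.0# j)
  φ-0# j = begin
    φ R.0# j                ≈⟨ φ-cong (R.sym (R.zeroʳ (ψ 0ₚ))) j ⟩
    φ (ψ 0ₚ R.* R.0#) j     ≈⟨ φ-ψ* 0ₚ R.0# j ⟩
    0# * φ R.0# j           ≈⟨ zeroˡ _ ⟩
    0#                      ∎
    where
      open Fᵢ j
      open SetoidReasoning setoid

  φ-sum : ∀ {m} (t : Vector R.Carrier m) j → Fᵢ._≈_ j (φ (sum t) j) (Sumᵢ.sum j (λ i → φ (t i) j))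
  φ-sum {zero}  t j = φ-0# j
  φ-sum {suc m} t j = Fᵢ.trans j (+-homo _ _ j) (Fᵢ.+-congˡ j (φ-sum (λ i → t (suc i)) j))

  _[_]≔_ : Prod R F → (i : Fin n) → Fᵢ.Carrier i → Prod R F
  (v [ i ]≔ a) j with j ≟ i
  ... | yes refl = a
  ... | no _     = v j

  []≔-diag : ∀ v i a → (v [ i ]≔ a) i ≡ a
  []≔-diag v i a with i ≟ i
  ... | yes refl = refl
  ... | no i≢i   = ⊥-elim (i≢i refl)

  []≔-off : ∀ v i a {j} → j ≢ i → (v [ i ]≔ a) j ≡ v j
  []≔-off v i a {j} j≢i with j ≟ i
  ... | yes refl = ⊥-elim (j≢i refl)
  ... | no _     = refl

  []≔-cong : ∀ v i {a b} j → Fᵢ._≈_ i a b → Fᵢ._≈_ j ((v [ i ]≔ a) j) ((v [ i ]≔ b) j)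
  []≔-cong v i j a≈b with j ≟ i
  ... | yes refl = a≈b
  ... | no _     = Fᵢ.refl j

  []≔-self : ∀ v i j → Fᵢ._≈_ j ((v [ i ]≔ v i) j) (v j)
  []≔-self v i j with j ≟ i
  ... | yes refl = Fᵢ.refl j
  ... | no _     = Fᵢ.refl j

  []≔-*-0ₚ : ∀ i a (w : Prod R F) j →
    Fᵢ._≈_ j (Fᵢ._*_ j ((0ₚ [ i ]≔ a) j) (w j)) ((0ₚ [ i ]≔ Fᵢ._*_ i a (w i)) j)
  []≔-*-0ₚ i a w j with j ≟ i
  ... | yes refl = Fᵢ.refl j
  ... | no _     = Fᵢ.zeroˡ j (w j)

  sum-[]≔-0ₚ : ∀ (w : Prod R F) j → Fᵢ._≈_ j (Sumᵢ.sum j (λ i → (0ₚ [ i ]≔ w i) j)) (w j)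
  sum-[]≔-0ₚ w j = Fᵢ.trans j
    (sum-concentrated (Fᵢ.+-commutativeMonoid j) _ j λ i i≢j → Fᵢ.reflexive j ([]≔-off 0ₚ i (w i) (≢-sym i≢j)))
    (Fᵢ.reflexive j ([]≔-diag 0ₚ j (w j)))

  e : Fin n → R.Carrier
  e i = ψ (0ₚ [ i ]≔ Fᵢ.1# i)

  φ-e-diag : ∀ i → Fᵢ._≈_ i (φ (e i) i) (Fᵢ.1# i)
  φ-e-diag i = Fᵢ.trans i (φ-ψ _ i) (Fᵢ.reflexive i ([]≔-diag 0ₚ i _))

  φ-e* : ∀ i x j → Fᵢ._≈_ j (φ (e i R.* x) j) ((0ₚ [ i ]≔ φ x i) j)
  φ-e* i x j = Fᵢ.trans j (φ-ψ* _ x j)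
    (Fᵢ.trans j ([]≔-*-0ₚ i _ (φ x) j) ([]≔-cong 0ₚ i j (Fᵢ.*-identityˡ i (φ x i))))

  e≉0 : ∀ i → ¬ e i R.≈ R.0#
  e≉0 i eᵢ≈0 = FieldPropertiesᵢ.1≉0 i
    (Fᵢ.trans i (Fᵢ.sym i (φ-e-diag i)) (Fᵢ.trans i (φ-cong eᵢ≈0 i) (φ-0# i)))

  e*≈0 : ∀ i {x} → Fᵢ._≈_ i (φ x i) (Fᵢ.0# i) → e i R.* x R.≈ R.0#
  e*≈0 i {x} xᵢ≈0 = injective λ j →
    Fᵢ.trans j (φ-e* i x j) (Fᵢ.trans j ([]≔-cong 0ₚ i j xᵢ≈0)
      (Fᵢ.trans j ([]≔-self 0ₚ i j) (Fᵢ.sym j (φ-0# j))))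

  x≈∑e*x : ∀ x → x R.≈ sum (λ i → e i R.* x)
  x≈∑e*x x = injective componentwise
    where
      componentwise : ∀ j → Fᵢ._≈_ j (φ x j) (φ (sum (λ i → e i R.* x)) j)
      componentwise j = begin
        φ x j                                     ≈⟨ sum-[]≔-0ₚ (φ x) j ⟨
        Sumᵢ.sum j (λ i → (0ₚ [ i ]≔ φ x i) j)    ≈⟨ Sumᵢ.sum-cong-≋ j (λ i → φ-e* i x j) ⟨
        Sumᵢ.sum j (λ i → φ (e i R.* x) j)        ≈⟨ φ-sum (λ i → e i R.* x) j ⟨
        φ (sum (λ i → e i R.* x)) j               ∎
        where open SetoidReasoning (Fᵢ.setoid j)

  module _ {P : Subset} (isIdeal : IsIdeal P) where
    open IsIdeal isIdeal

    ∈⇒e∈ : ∀ {x} i → P x → ¬ Fᵢ._≈_ i (φ x i) (Fᵢ.0# i) → P (e i)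
    ∈⇒e∈ {x} i x∈P xᵢ≉0 = resp (injective componentwise) (*-closed y x∈P)
      where
        open FieldPropertiesᵢ i using (_⁻¹[_]; inverseˡ)
        y = ψ (0ₚ [ i ]≔ (φ x i ⁻¹[ xᵢ≉0 ]))
        componentwise : ∀ j → Fᵢ._≈_ j (φ (y R.* x) j) (φ (e i) j)
        componentwise j = Fᵢ.trans j (φ-ψ* _ x j) (Fᵢ.trans j ([]≔-*-0ₚ i _ (φ x) j)
          (Fᵢ.trans j ([]≔-cong 0ₚ i j (inverseˡ (φ x i) xᵢ≉0)) (Fᵢ.sym j (φ-ψ _ j))))

    e∈⇒∈ : ∀ {x} → (∀ i → ¬ Fᵢ._≈_ i (φ x i) (Fᵢ.0# i) → P (e i)) → P x
    e∈⇒∈ {x} supp⊆P = resp (R.sym (x≈∑e*x x)) (sum-closed isIdeal _ e*x∈P)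
      where
        e*x∈P : ∀ i → P (e i R.* x)
        e*x∈P i with ≈0? i (φ x i)
        ... | yes xᵢ≈0 = resp (R.sym (e*≈0 i xᵢ≈0)) zero∈
        ... | no xᵢ≉0  = resp (R.*-comm x (e i)) (*-closed x (supp⊆P i xᵢ≉0))

    missing-one⇒prime : ∀ m → ¬ P (e m) → (∀ j → j ≢ m → P (e j)) → IsPrime P
    missing-one⇒prime m eₘ∉P others = record
      { isIdeal = isIdeal
      ; proper  = ∉⇒1∉ isIdeal eₘ∉P
      ; prime   = prime
      }
      where
        open Fᵢ m
        open FieldPropertiesᵢ m using (*-≉0)
        vanishing⇒∈ : ∀ {x} → φ x m ≈ 0# → P x
        vanishing⇒∈ xₘ≈0 = e∈⇒∈ λ { j xⱼ≉0 → others j λ { refl → xⱼ≉0 xₘ≈0 } }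
        prime : ∀ a b → P (a R.* b) → P a ⊎ P b
        prime a b ab∈P with ≈0? m (φ a m) | ≈0? m (φ b m)
        ... | yes aₘ≈0 | _          = inj₁ (vanishing⇒∈ aₘ≈0)
        ... | no _     | yes bₘ≈0   = inj₂ (vanishing⇒∈ bₘ≈0)
        ... | no aₘ≉0  | no bₘ≉0    = ⊥-elim (eₘ∉P (∈⇒e∈ m ab∈P λ abₘ≈0 →
                                        *-≉0 aₘ≉0 bₘ≉0 (trans (sym (*-homo a b m)) abₘ≈0)))

  e⊆⇒⊆ : (I J : Ideal) → (∀ i → set I (e i) → set J (e i)) → ∀ x → set I x → set J x
  e⊆⇒⊆ I J e⊆ x x∈I = e∈⇒∈ (isIdeal J) λ i xᵢ≉0 → e⊆ i (∈⇒e∈ (isIdeal I) i x∈I xᵢ≉0)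

  e∈⊕ : (I K : Ideal) → ∀ m → (I ⊕ K) (e m) → set I (e m) ⊎ set K (e m)
  e∈⊕ I K m (a , b , a∈I , b∈K , eₘ≈a+b) with ≈0? m (φ a m)
  ... | no aₘ≉0  = inj₁ (∈⇒e∈ (isIdeal I) m a∈I aₘ≉0)
  ... | yes aₘ≈0 = inj₂ (∈⇒e∈ (isIdeal K) m b∈K λ bₘ≈0 → FieldPropertiesᵢ.1≉0 m (begin
    1#                  ≈⟨ φ-e-diag m ⟨
    φ (e m) m           ≈⟨ φ-cong eₘ≈a+b m ⟩
    φ (a R.+ b) m       ≈⟨ +-homo a b m ⟩
    φ a m + φ b m       ≈⟨ +-cong aₘ≈0 bₘ≈0 ⟩
    0# + 0#             ≈⟨ +-identityˡ 0# ⟩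
    0#                  ∎))
    where
      open Fᵢ m
      open SetoidReasoning setoid

  e∈⟨ψ⟩ : ∀ v k → ¬ Fᵢ._≈_ k (v k) (Fᵢ.0# k) → set ⟨ ψ v ⟩ (e k)
  e∈⟨ψ⟩ v k vₖ≉0 = ∈⇒e∈ (isIdeal ⟨ ψ v ⟩) k (R.1# , R.sym (R.*-identityˡ (ψ v)))
    λ ψvₖ≈0 → vₖ≉0 (Fᵢ.trans k (Fᵢ.sym k (φ-ψ v k)) ψvₖ≈0)

  e∉⟨ψ⟩ : ∀ v k → Fᵢ._≈_ k (v k) (Fᵢ.0# k) → ¬ set ⟨ ψ v ⟩ (e k)
  e∉⟨ψ⟩ v k vₖ≈0 (r , eₖ≈rψv) = FieldPropertiesᵢ.1≉0 k (begin
    1#                  ≈⟨ φ-e-diag k ⟨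
    φ (e k) k           ≈⟨ φ-cong eₖ≈rψv k ⟩
    φ (r R.* ψ v) k     ≈⟨ *-homo r (ψ v) k ⟩
    φ r k * φ (ψ v) k   ≈⟨ *-congˡ (trans (φ-ψ v k) vₖ≈0) ⟩
    φ r k * 0#          ≈⟨ zeroʳ _ ⟩
    0#                  ∎)
    where
      open Fᵢ k
      open SetoidReasoning setoid

  𝔪 : Fin n → Ideal
  𝔪 i = ⟨ ψ (1ₚ [ i ]≔ Fᵢ.0# i) ⟩

  e∈𝔪 : ∀ {i k} → k ≢ i → set (𝔪 i) (e k)
  e∈𝔪 {i} {k} k≢i = e∈⟨ψ⟩ _ k λ ≈0 →
    FieldPropertiesᵢ.1≉0 k (Fᵢ.trans k (Fᵢ.reflexive k (PropEq.sym ([]≔-off 1ₚ i _ k≢i))) ≈0)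

  e∉𝔪 : ∀ i → ¬ set (𝔪 i) (e i)
  e∉𝔪 i = e∉⟨ψ⟩ _ i (Fᵢ.reflexive i ([]≔-diag 1ₚ i _))

  e∈⟨e⟩ : ∀ i → set ⟨ e i ⟩ (e i)
  e∈⟨e⟩ i = e∈⟨ψ⟩ _ i λ ≈0 →
    FieldPropertiesᵢ.1≉0 i (Fᵢ.trans i (Fᵢ.reflexive i (PropEq.sym ([]≔-diag 0ₚ i _))) ≈0)

  e∉⟨e⟩ : ∀ {i k} → k ≢ i → ¬ set ⟨ e i ⟩ (e k)
  e∉⟨e⟩ {i} {k} k≢i = e∉⟨ψ⟩ _ k (Fᵢ.reflexive k ([]≔-off 0ₚ i _ k≢i))

  vertex : ∀ X {a b} → set X (e a) → ¬ set X (e b) → IsVertex X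
  vertex X {a} eₐ∈X e_b∉X = (e a , eₐ∈X , e≉0 a) , ∉⇒1∉ (isIdeal X) e_b∉X

  vertex⇒e∉ : ∀ X → IsVertex X → ¬ (∀ i → set X (e i))
  vertex⇒e∉ X (_ , 1∉X) e∈X = 1∉X (e∈⇒∈ (isIdeal X) λ i _ → e∈X i)

  neighbour : ∀ X K a m → set K (e a) → ¬ (K ≐ X) → ¬ set X (e m) → ¬ set K (e m) →
              (∀ j → j ≢ m → (X ⊕ K) (e j)) → K ∈N[ X ]
  neighbour X K a m eₐ∈K K≉X eₘ∉X eₘ∉K others =
    vertex K eₐ∈K eₘ∉K , K≉X ,
    missing-one⇒prime (⊕-isIdeal X K) m (λ eₘ∈X⊕K → [ eₘ∉X , eₘ∉K ]′ (e∈⊕ X K m eₘ∈X⊕K)) others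

  ¬neighbour : ∀ X K → (∀ j → (X ⊕ K) (e j)) → ¬ K ∈N[ X ]
  ¬neighbour X K e∈X⊕K (_ , _ , X⊕K-prime) =
    IsPrime.proper X⊕K-prime (e∈⇒∈ (IsPrime.isIdeal X⊕K-prime) λ j _ → e∈X⊕K j)

  𝔪-neighbour : ∀ X m k → k ≢ m → ¬ set X (e m) → ¬ set X (e k) → 𝔪 m ∈N[ X ]
  𝔪-neighbour X m k k≢m eₘ∉X eₖ∉X =
    neighbour X (𝔪 m) k m (e∈𝔪 k≢m) (λ 𝔪≐X → eₖ∉X (proj₁ 𝔪≐X _ (e∈𝔪 k≢m))) eₘ∉X (e∉𝔪 m)
      λ j j≢m → ⊕-inʳ X (𝔪 m) (e∈𝔪 j≢m)

  ⟨e⟩-neighbour : ∀ X i m k → i ≢ m → k ≢ i → k ≢ m →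
                  ¬ set X (e m) → (∀ j → j ≢ m → set X (e j)) → ⟨ e i ⟩ ∈N[ X ]
  ⟨e⟩-neighbour X i m k i≢m k≢i k≢m eₘ∉X others =
    neighbour X ⟨ e i ⟩ i m (e∈⟨e⟩ i) (λ ⟨e⟩≐X → e∉⟨e⟩ k≢i (proj₂ ⟨e⟩≐X _ (others k k≢m))) eₘ∉X (e∉⟨e⟩ (≢-sym i≢m))
      λ j j≢m → ⊕-inˡ X ⟨ e i ⟩ (others j j≢m)

  module _ (avoid-two : ∀ (i m : Fin n) → ∃ λ k → k ≢ i × k ≢ m)
           (I J : Ideal) (vertexI : IsVertex I) (same : SameNeighbourhood I J)
           (e∈I? : ∀ i → Dec (set I (e i))) (e∈J? : ∀ i → Dec (set J (e i)))
           {i} (eᵢ∈I : set I (e i)) (eᵢ∉J : ¬ set J (e i)) where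

    J-contains-others : ∀ j → j ≢ i → set J (e j)
    J-contains-others j j≢i = decidable-stable (e∈J? j) λ eⱼ∉J →
      ¬neighbour I (𝔪 i) (all-but-one i (⊕-inˡ I (𝔪 i) eᵢ∈I) λ k k≢i → ⊕-inʳ I (𝔪 i) (e∈𝔪 k≢i))
        (proj₂ (same (𝔪 i)) (𝔪-neighbour J i j j≢i eᵢ∉J eⱼ∉J))

    J⊕-covers : ∀ K → set K (e i) → ∀ j → (J ⊕ K) (e j)
    J⊕-covers K eᵢ∈K = all-but-one i (⊕-inʳ J K eᵢ∈K) λ j j≢i → ⊕-inˡ J K (J-contains-others j j≢i)

    I-contains-others : ∀ m → ¬ set I (e m) → ∀ k → k ≢ m → set I (e k)
    I-contains-others m eₘ∉I k k≢m = decidable-stable (e∈I? k) λ eₖ∉I →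
      ¬neighbour J (𝔪 m) (J⊕-covers (𝔪 m) (e∈𝔪 λ { refl → eₘ∉I eᵢ∈I }))
        (proj₁ (same (𝔪 m)) (𝔪-neighbour I m k k≢m eₘ∉I eₖ∉I))

    I-contains-all : ∀ m → set I (e m)
    I-contains-all m = decidable-stable (e∈I? m) λ eₘ∉I →
      let (k , k≢i , k≢m) = avoid-two i m in
      ¬neighbour J ⟨ e i ⟩ (J⊕-covers ⟨ e i ⟩ (e∈⟨e⟩ i))
        (proj₁ (same ⟨ e i ⟩) (⟨e⟩-neighbour I i m k (λ { refl → eₘ∉I eᵢ∈I }) k≢i k≢m eₘ∉I
          (I-contains-others m eₘ∉I)))

    separating-unit-absurd : ⊥
    separating-unit-absurd = vertex⇒e∉ I vertexI I-contains-all

  same-neighbourhood⇒≐ : (∀ (i m : Fin n) → ∃ λ k → k ≢ i × k ≢ m) →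
    ∀ I J → IsVertex I → IsVertex J → SameNeighbourhood I J → ¬ ¬ (I ≐ J)
  same-neighbourhood⇒≐ avoid-two I J vertexI vertexJ same I≉J =
    ¬¬-sequence (λ _ → ¬¬-excluded-middle) λ e∈I? →
    ¬¬-sequence (λ _ → ¬¬-excluded-middle) λ e∈J? →
    I≉J ( e⊆⇒⊆ I J (transfer I J vertexI same e∈I? e∈J?)
        , e⊆⇒⊆ J I (transfer J I vertexJ (λ K → swap (same K)) e∈J? e∈I?))
    where
      transfer : ∀ X Y → IsVertex X → SameNeighbourhood X Y →
                 (∀ i → Dec (set X (e i))) → (∀ i → Dec (set Y (e i))) →
                 ∀ i → set X (e i) → set Y (e i)
      transfer X Y vertexX sameXY e∈X? e∈Y? i eᵢ∈X = decidable-stable (e∈Y? i)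
        (separating-unit-absurd avoid-two X Y vertexX sameXY e∈X? e∈Y? eᵢ∈X)

lemma3p1 : ∀ {c ℓ c' ℓ'} (R : CommutativeRing c ℓ) (n : ℕ) → n ≥ 3 →
    (F : Fin n → CommutativeRing c' ℓ') →
    (∀ i → IsField (F i)) → (∀ i → IsFinite (F i)) →
    _≅Π_ R F →
    let open IdealTheory R in
    (I J : Ideal) → IsVertex I → IsVertex J → ¬ (I ≐ J) →
    ¬ SameNeighbourhood I J
lemma3p1 R (suc (suc (suc n))) (s≤s (s≤s (s≤s z≤n))) F isField finite (φ , isIso)
         I J vertexI vertexJ I≉J same =
  ¬¬-sequence (λ i → finite⇒¬¬-decidable (F i) (finite i) (≈0-respects (F i))) λ ≈0? →
  ProductOfFields.same-neighbourhood⇒≐ R F isField φ isIso ≈0?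
    avoid-two I J vertexI vertexJ same I≉J
  where
    ≈0-respects : ∀ {c ℓ} (K : CommutativeRing c ℓ) → let open CommutativeRing K in (_≈ 0#) Respects _≈_
    ≈0-respects K x≈y x≈0 = trans (sym x≈y) x≈0
      where open CommutativeRing K
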